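{- Let $k$ and $c$ be positive integers. If every t-perfect graph with no odd cycle of length at most $2k+1$ is $c$-colourable, then every t-perfect graph is $(c+k)$-colourable.
   Context: All graphs are finite and simple. For a graph $G=(V,E)$, $\mathrm{STAB}(G)\subseteq\mathbb{R}^V$ is the convex hull of the incidence vectors of stable sets of $G$, and $\mathrm{TSTAB}(G)$ is the set of $x\in\mathbb{R}^V$ with $x_v\ge0$ for all vertices $v$, $x_u+x_v\le 1$ for all edges $uv$, and $\sum_{v\in V(C)}x_v\le\frac{|V(C)|-1}{2}$ for every odd cycle $C$. $G$ is t-perfect if $\mathrm{STAB}(G)=\mathrm{TSTAB}(G)$. A graph is $k$-colourable if its vertex set is a union of $k$ stable sets.
   Formalization: For t-perfection, $\mathrm{STAB}(G)$ and $\mathrm{TSTAB}(G)$ are taken in ℚ^V instead of $\mathbb{R}^V$, with the convex combinations forming $\mathrm{STAB}(G)$ having rational coefficients. -}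

module Defs where

open import Data.Nat using (ℕ; zero; suc; _+_; _≤_)
open import Data.Integer using (+_)
open import Data.Rational using (ℚ; 0ℚ; 1ℚ; _/_) renaming (_+_ to _+ℚ_; _*_ to _*ℚ_; _≤_ to _≤ℚ_)
open import Data.Fin using (Fin; zero; suc; inject₁; fromℕ)
open import Data.Bool using (Bool; true; false)
open import Data.List using (List; []; _∷_)
open import Data.Product using (Σ; _×_; _,_; ∃)
open import Relation.Nullary using (¬_)
open import Relation.Binary.PropositionalEquality using (_≡_)
open import Function.Definitions using (Injective)
open import Level using (0ℓ)

record Graph (n : ℕ) : Set₁ where
  field
    Adj    : Fin n → Fin n → Set
    sym    : ∀ {u v} → Adj u v → Adj v u
    irrefl : ∀ {u} → ¬ Adj u u
open Graph public

VSet : ℕ → Set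
VSet n = Fin n → Bool

Stable : ∀ {n} → Graph n → VSet n → Set
Stable G S = ∀ u v → Adj G u v → ¬ (S u ≡ true × S v ≡ true)

Σℚ : ∀ {m} → (Fin m → ℚ) → ℚ
Σℚ {zero}  f = 0ℚ
Σℚ {suc m} f = f zero +ℚ Σℚ (λ i → f (suc i))

fromℕℚ : ℕ → ℚ
fromℕℚ k = + k / 1

χ : ∀ {n} → VSet n → Fin n → ℚ
χ S v with S v
... | true  = 1ℚ
... | false = 0ℚ

weightSum : ∀ {n} → List (ℚ × VSet n) → ℚ
weightSum []             = 0ℚ
weightSum ((l , _) ∷ cs) = l +ℚ weightSum cs

combo : ∀ {n} → List (ℚ × VSet n) → Fin n → ℚ
combo []             v = 0ℚ
combo ((l , S) ∷ cs) v = (l *ℚ χ S v) +ℚ combo cs v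

AllStableNonneg : ∀ {n} → Graph n → List (ℚ × VSet n) → Set
AllStableNonneg G []             = Data.Unit.⊤ where import Data.Unit
AllStableNonneg G ((l , S) ∷ cs) = (0ℚ ≤ℚ l) × Stable G S × AllStableNonneg G cs

InSTAB : ∀ {n} → Graph n → (Fin n → ℚ) → Set
InSTAB {n} G x =
  Σ (List (ℚ × VSet n)) λ cs →
    AllStableNonneg G cs × (weightSum cs ≡ 1ℚ) × (∀ v → combo cs v ≡ x v)

record OddCycle {n} (G : Graph n) : Set where
  field
    j     : ℕ
    vert  : Fin (suc (suc (suc (j + j)))) → Fin n
    inj   : Injective _≡_ _≡_ vert
    step  : ∀ (i : Fin (suc (suc (j + j)))) → Adj G (vert (inject₁ i)) (vert (suc i))
    close : Adj G (vert (fromℕ (suc (suc (j + j))))) (vert zero)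
  length : ℕ
  length = suc (suc (suc (j + j)))
open OddCycle public

-- x ∈ TSTAB(G).  For a cycle of length 2j+3, (|V(C)|-1)/2 = j+1.
InTSTAB : ∀ {n} → Graph n → (Fin n → ℚ) → Set
InTSTAB G x =
  (∀ v → 0ℚ ≤ℚ x v) ×
  (∀ u v → Adj G u v → (x u +ℚ x v) ≤ℚ 1ℚ) ×
  (∀ (C : OddCycle G) → Σℚ (λ i → x (vert C i)) ≤ℚ fromℕℚ (suc (j C)))

TPerfect : ∀ {n} → Graph n → Set
TPerfect G = ∀ x → (InSTAB G x → InTSTAB G x) × (InTSTAB G x → InSTAB G x)

Colourable : ℕ → ∀ {n} → Graph n → Set
Colourable k {n} G =
  Σ (Fin k → VSet n) λ S → (∀ i → Stable G (S i)) × (∀ v → ∃ λ i → S i v ≡ true)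

NoShortOddCycle : ℕ → ∀ {n} → Graph n → Set
NoShortOddCycle k G = ∀ (C : OddCycle G) → ¬ (length C ≤ suc (k + k))

module Submission where

-- If every odd cycle inside W has length at least 2i + 3, the point with weight
-- (i + 1)/(2i + 3) on W lies in TSTAB.  In a t-perfect graph it is therefore a
-- convex combination of stable sets, and as the odd cycles of length 2i + 3 inside W
-- are tight, every stable set of positive weight meets all of them.  Removing such
-- stable sets for i = 0, …, k - 1 leaves a set W without odd cycles of length at
-- most 2k + 1.  Attaching a pendant vertex to every vertex of G[W] preserves
-- t-perfection, since a pendant vertex can be added to a suitable fraction of the
-- stable sets avoiding its neighbour.  So that graph is c-colourable, and its
-- colouring together with the k removed stable sets is a (c + k)-colouring of G.

open import Defs hiding (sym)

open import Data.Bool using (Bool; true; false; not; _∧_; if_then_else_)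
import Data.Bool as Bool
import Data.Bool.Properties as Boolₚ
open import Data.Empty using (⊥; ⊥-elim)
open import Data.Fin as Fin
  using (Fin; zero; suc; toℕ; inject₁; fromℕ; lower₁; splitAt; _↑ˡ_; _↑ʳ_)
open import Data.Fin.Induction using (<-weakInduction)
import Data.Fin.Properties as Finₚ
open import Data.Integer using (+_)
import Data.Integer.Properties as ℤₚ
open import Data.List using (List; []; _∷_; allFin)
open import Data.List.Membership.Propositional using (_∈_)
open import Data.List.Membership.Propositional.Properties using (∈-allFin)
open import Data.List.Relation.Unary.Any using (here; there)
open import Data.Nat as ℕ using (ℕ; zero; suc; _+_; _≤_; z≤n; s≤s)
open import Data.Nat.Coprimality using (1-coprimeTo)
import Data.Nat.Coprimality as Coprime
import Data.Nat.Properties as ℕₚ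
open import Data.Nat.Tactic.RingSolver using (solve-∀)
open import Data.Product using (_×_; _,_; ∃; ∃₂; proj₁; proj₂; map₂)
open import Data.Rational as ℚ using (ℚ; 0ℚ; 1ℚ; 1/_)
  renaming (_+_ to _+ℚ_; _*_ to _*ℚ_; _-_ to _-ℚ_; _≤_ to _≤ℚ_; _<_ to _<ℚ_)
open import Data.Rational.Properties
open import Data.Rational.Solver using (module +-*-Solver)
open import Data.Sum using (_⊎_; inj₁; inj₂; [_,_]′)
open import Data.Vec.Functional using (Vector; tail; updateAt; _++_)
open import Data.Vec.Functional.Properties
  using (updateAt-updates; updateAt-minimal; updateAt-id-local; lookup-++ˡ; lookup-++ʳ)
open import Data.Vec.Functional.Relation.Unary.All.Properties using (++⁺)
open import Function using (_∘_)
open import Relation.Binary.PropositionalEquality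
open import Relation.Nullary using (¬_; yes; no; contradiction)

open +-*-Solver using (solve; _:+_; _:*_; _:-_; _:=_; con)
open import Algebra.Properties.CommutativeMonoid.Sum +-0-commutativeMonoid
  using (sum; sum-init-last; sum-cong-≗)

-- fromℕℚ k normalises to mkℚ (+ k) 0 _, on which 1ℚ +ℚ_ computes.
fromℕℚ-suc : ∀ k → fromℕℚ (suc k) ≡ 1ℚ +ℚ fromℕℚ k
fromℕℚ-suc k
  rewrite normalize-coprime {k} {0} (Coprime.sym (1-coprimeTo k))
        | ℤₚ.*-identityʳ (+ k) = refl

fromℕℚ-+ : ∀ m n → fromℕℚ (m + n) ≡ fromℕℚ m +ℚ fromℕℚ n
fromℕℚ-+ zero    n = sym (+-identityˡ (fromℕℚ n))
fromℕℚ-+ (suc m) n = begin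
  fromℕℚ (suc (m + n))              ≡⟨ fromℕℚ-suc (m + n) ⟩
  1ℚ +ℚ fromℕℚ (m + n)              ≡⟨ cong (1ℚ +ℚ_) (fromℕℚ-+ m n) ⟩
  1ℚ +ℚ (fromℕℚ m +ℚ fromℕℚ n)      ≡⟨ sym (+-assoc 1ℚ (fromℕℚ m) (fromℕℚ n)) ⟩
  (1ℚ +ℚ fromℕℚ m) +ℚ fromℕℚ n      ≡⟨ cong (_+ℚ fromℕℚ n) (sym (fromℕℚ-suc m)) ⟩
  fromℕℚ (suc m) +ℚ fromℕℚ n        ∎
  where open ≡-Reasoning

fromℕℚ-* : ∀ m n → fromℕℚ (m ℕ.* n) ≡ fromℕℚ m *ℚ fromℕℚ n
fromℕℚ-* zero    n = sym (*-zeroˡ (fromℕℚ n))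
fromℕℚ-* (suc m) n = begin
  fromℕℚ (n + m ℕ.* n)                   ≡⟨ fromℕℚ-+ n (m ℕ.* n) ⟩
  fromℕℚ n +ℚ fromℕℚ (m ℕ.* n)           ≡⟨ cong (fromℕℚ n +ℚ_) (fromℕℚ-* m n) ⟩
  fromℕℚ n +ℚ fromℕℚ m *ℚ fromℕℚ n       ≡⟨ cong (_+ℚ fromℕℚ m *ℚ fromℕℚ n) (sym (*-identityˡ (fromℕℚ n))) ⟩
  1ℚ *ℚ fromℕℚ n +ℚ fromℕℚ m *ℚ fromℕℚ n ≡⟨ sym (*-distribʳ-+ (fromℕℚ n) 1ℚ (fromℕℚ m)) ⟩
  (1ℚ +ℚ fromℕℚ m) *ℚ fromℕℚ n           ≡⟨ cong (_*ℚ fromℕℚ n) (sym (fromℕℚ-suc m)) ⟩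
  fromℕℚ (suc m) *ℚ fromℕℚ n             ∎
  where open ≡-Reasoning

0≤1 : 0ℚ ≤ℚ 1ℚ
0≤1 = <⇒≤ (positive⁻¹ 1ℚ)

fromℕℚ-nonNeg : ∀ n → 0ℚ ≤ℚ fromℕℚ n
fromℕℚ-nonNeg zero    = ≤-refl
fromℕℚ-nonNeg (suc n) rewrite fromℕℚ-suc n = +-mono-≤ 0≤1 (fromℕℚ-nonNeg n)

fromℕℚ-pos : ∀ n → 0ℚ <ℚ fromℕℚ (suc n)
fromℕℚ-pos n rewrite fromℕℚ-suc n = +-mono-<-≤ (positive⁻¹ 1ℚ) (fromℕℚ-nonNeg n)

fromℕℚ-mono-≤ : ∀ {m n} → m ≤ n → fromℕℚ m ≤ℚ fromℕℚ n
fromℕℚ-mono-≤ {n = n} z≤n = fromℕℚ-nonNeg n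
fromℕℚ-mono-≤ {suc m} {suc n} (s≤s m≤n)
  rewrite fromℕℚ-suc m | fromℕℚ-suc n = +-monoʳ-≤ 1ℚ (fromℕℚ-mono-≤ m≤n)

-- Odd cycles through a vertex of weight zero

next : ∀ {m} → Fin (suc m) → Fin (suc m)
next {zero}  _       = zero
next {suc m} zero    = suc zero
next {suc m} (suc i) = wrap (next i)
  where
  wrap : Fin (suc m) → Fin (suc (suc m))
  wrap zero    = zero
  wrap (suc k) = suc (suc k)

next-inject₁ : ∀ {m} (i : Fin m) → next (inject₁ i) ≡ suc i
next-inject₁ {suc m} zero    = refl
next-inject₁ {suc m} (suc i) rewrite next-inject₁ i = refl

next-fromℕ : ∀ m → next (fromℕ m) ≡ zero
next-fromℕ zero    = refl
next-fromℕ (suc m) rewrite next-fromℕ m = refl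

fromℕ-or-inject₁ : ∀ {m} (i : Fin (suc m)) → i ≡ fromℕ m ⊎ ∃ λ i′ → i ≡ inject₁ i′
fromℕ-or-inject₁ {m} i with m ℕ.≟ toℕ i
... | yes m≡i = inj₁ (Finₚ.toℕ-injective (trans (sym m≡i) (sym (Finₚ.toℕ-fromℕ m))))
... | no  m≢i = inj₂ (lower₁ i m≢i , sym (Finₚ.inject₁-lower₁ i m≢i))

sum-next : ∀ {m} (g : Vector ℚ (suc m)) → sum (g ∘ next) ≡ sum g
sum-next {m} g = begin
  sum (g ∘ next)                                  ≡⟨ sum-init-last (g ∘ next) ⟩
  sum (g ∘ next ∘ inject₁) +ℚ g (next (fromℕ m))  ≡⟨ cong₂ _+ℚ_ (sum-cong-≗ (cong g ∘ next-inject₁))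
                                                               (cong g (next-fromℕ m)) ⟩
  sum (tail g) +ℚ g zero                          ≡⟨ +-comm (sum (tail g)) (g zero) ⟩
  sum g                                           ∎
  where open ≡-Reasoning

PathBounded : ∀ {m} → Vector ℚ (suc m) → Set
PathBounded g = ∀ i → g (inject₁ i) +ℚ g (suc i) ≤ℚ 1ℚ

CycleBounded : ∀ {m} → Vector ℚ (suc m) → Set
CycleBounded g = ∀ i → g i +ℚ g (next i) ≤ℚ 1ℚ

EdgeBounded : ∀ {n} → Graph n → (Fin n → ℚ) → Set
EdgeBounded G f = ∀ u v → Adj G u v → f u +ℚ f v ≤ℚ 1ℚ

CycleBounded⇒PathBounded-tail : ∀ {m} {g : Vector ℚ (suc (suc m))} →
  CycleBounded g → PathBounded (tail g)
CycleBounded⇒PathBounded-tail {g = g} bounded i =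
  subst (λ k → g (suc (inject₁ i)) +ℚ g k ≤ℚ 1ℚ) (next-inject₁ (suc i)) (bounded (suc (inject₁ i)))

-- An even path on 2j + 2 vertices is covered by the j + 1 edges {0,1}, {2,3}, …
evenPath-bound : ∀ j {m} → m ≡ j + j → (g : Vector ℚ (suc (suc m))) →
  PathBounded g → sum g ≤ℚ fromℕℚ (suc j)
evenPath-bound zero    refl g bounded =
  ≤-trans (≤-reflexive (cong (g zero +ℚ_) (+-identityʳ (g (suc zero))))) (bounded zero)
evenPath-bound (suc j) {suc zero} 1≡ _ _ =
  contradiction (trans (ℕₚ.suc-injective 1≡) (ℕₚ.+-suc j j)) ℕₚ.0≢1+n
evenPath-bound (suc j) {suc (suc m)} eq g bounded = begin
  g zero +ℚ (g (suc zero) +ℚ sum rest)  ≡⟨ sym (+-assoc (g zero) (g (suc zero)) (sum rest)) ⟩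
  (g zero +ℚ g (suc zero)) +ℚ sum rest  ≤⟨ +-mono-≤ (bounded zero)
                                              (evenPath-bound j m≡j+j rest (λ i → bounded (suc (suc i)))) ⟩
  1ℚ +ℚ fromℕℚ (suc j)                  ≡⟨ sym (fromℕℚ-suc (suc j)) ⟩
  fromℕℚ (suc (suc j))                  ∎
  where
  open ≤-Reasoning
  rest : Vector ℚ (suc (suc m))
  rest = tail (tail g)
  m≡j+j : m ≡ j + j
  m≡j+j = ℕₚ.suc-injective (ℕₚ.suc-injective (trans eq (cong suc (ℕₚ.+-suc j j))))

-- Rotating a zero to the front and deleting it leaves a path.
cycle-bound : ∀ {m B} → (∀ (h : Vector ℚ (suc m)) → PathBounded h → sum h ≤ℚ B) →
  (g : Vector ℚ (suc (suc m))) → CycleBounded g → ∀ p → g p ≡ 0ℚ → sum g ≤ℚ B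
cycle-bound {m} {B} path-bound g bounded p gp≡0 = <-weakInduction P base rotate p g bounded gp≡0
  where
  P : Fin (suc (suc m)) → Set
  P p = ∀ g → CycleBounded g → g p ≡ 0ℚ → sum g ≤ℚ B

  base : P zero
  base g bounded g0≡0 = begin
    g zero +ℚ sum (tail g)  ≡⟨ cong (_+ℚ sum (tail g)) g0≡0 ⟩
    0ℚ +ℚ sum (tail g)      ≡⟨ +-identityˡ (sum (tail g)) ⟩
    sum (tail g)            ≤⟨ path-bound (tail g) (CycleBounded⇒PathBounded-tail {g = g} bounded) ⟩
    B                       ∎
    where open ≤-Reasoning

  rotate : ∀ i → P (inject₁ i) → P (suc i)
  rotate i ih g bounded gi≡0 = begin
    sum g           ≡⟨ sum-next g ⟨
    sum (g ∘ next)  ≤⟨ ih (g ∘ next) (λ i → bounded (next i)) (trans (cong g (next-inject₁ i)) gi≡0) ⟩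
    B               ∎
    where open ≤-Reasoning

Σℚ-cong : ∀ {m} {f g : Fin m → ℚ} → (∀ i → f i ≡ g i) → Σℚ f ≡ Σℚ g
Σℚ-cong {zero}  f≗g = refl
Σℚ-cong {suc m} f≗g = cong₂ _+ℚ_ (f≗g zero) (Σℚ-cong (λ i → f≗g (suc i)))

Σℚ-const : ∀ {m} a → Σℚ {m} (λ _ → a) ≡ fromℕℚ m *ℚ a
Σℚ-const {zero}  a = sym (*-zeroˡ a)
Σℚ-const {suc m} a = begin
  a +ℚ Σℚ {m} (λ _ → a)         ≡⟨ cong (a +ℚ_) (Σℚ-const {m} a) ⟩
  a +ℚ fromℕℚ m *ℚ a            ≡⟨ cong (_+ℚ fromℕℚ m *ℚ a) (sym (*-identityˡ a)) ⟩
  1ℚ *ℚ a +ℚ fromℕℚ m *ℚ a      ≡⟨ sym (*-distribʳ-+ a 1ℚ (fromℕℚ m)) ⟩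
  (1ℚ +ℚ fromℕℚ m) *ℚ a         ≡⟨ cong (_*ℚ a) (sym (fromℕℚ-suc m)) ⟩
  fromℕℚ (suc m) *ℚ a           ∎
  where open ≡-Reasoning

Σℚ≡sum : ∀ {m} (f : Fin m → ℚ) → Σℚ f ≡ sum f
Σℚ≡sum {zero}  f = refl
Σℚ≡sum {suc m} f = cong (f zero +ℚ_) (Σℚ≡sum (tail f))

adj-next : ∀ {n} {G : Graph n} (C : OddCycle G) i → Adj G (vert C i) (vert C (next i))
adj-next {G = G} C i with fromℕ-or-inject₁ i
... | inj₁ refl        = subst (Adj G (vert C i) ∘ vert C) (sym (next-fromℕ _)) (close C)
... | inj₂ (i′ , refl) = subst (Adj G (vert C i) ∘ vert C) (sym (next-inject₁ i′)) (step C i′)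

oddCycle-bound : ∀ {n} {G : Graph n} {f : Fin n → ℚ} → EdgeBounded G f → (C : OddCycle G) →
  ∀ p → f (vert C p) ≡ 0ℚ → Σℚ (λ i → f (vert C i)) ≤ℚ fromℕℚ (suc (j C))
oddCycle-bound {f = f} bounded C p fp≡0 = begin
  Σℚ (f ∘ vert C)     ≡⟨ Σℚ≡sum (f ∘ vert C) ⟩
  sum (f ∘ vert C)    ≤⟨ cycle-bound (evenPath-bound (j C) refl) (f ∘ vert C)
                           (λ i → bounded _ _ (adj-next C i)) p fp≡0 ⟩
  fromℕℚ (suc (j C))  ∎
  where open ≤-Reasoning

-- Convex combinations of stable sets

weightedSum : ∀ {n} → List (ℚ × VSet n) → (VSet n → ℚ) → ℚ
weightedSum []             h = 0ℚ
weightedSum ((l , S) ∷ cs) h = l *ℚ h S +ℚ weightedSum cs h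

module _ {n : ℕ} where

  combo≡weightedSum : ∀ (cs : List (ℚ × VSet n)) v → combo cs v ≡ weightedSum cs (λ S → χ S v)
  combo≡weightedSum []             v = refl
  combo≡weightedSum ((l , S) ∷ cs) v = cong (l *ℚ χ S v +ℚ_) (combo≡weightedSum cs v)

  weightedSum-cong : ∀ (cs : List (ℚ × VSet n)) {h h′} → (∀ S → h S ≡ h′ S) →
    weightedSum cs h ≡ weightedSum cs h′
  weightedSum-cong []             h≗h′ = refl
  weightedSum-cong ((l , S) ∷ cs) h≗h′ =
    cong₂ (λ a b → l *ℚ a +ℚ b) (h≗h′ S) (weightedSum-cong cs h≗h′)

  weightedSum-+ : ∀ (cs : List (ℚ × VSet n)) h h′ →
    weightedSum cs (λ S → h S +ℚ h′ S) ≡ weightedSum cs h +ℚ weightedSum cs h′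
  weightedSum-+ []             h h′ = sym (+-identityˡ 0ℚ)
  weightedSum-+ ((l , S) ∷ cs) h h′ rewrite weightedSum-+ cs h h′ =
    solve 5 (λ l a b c d → l :* (a :+ b) :+ (c :+ d) := (l :* a :+ c) :+ (l :* b :+ d))
      refl l (h S) (h′ S) (weightedSum cs h) (weightedSum cs h′)

  weightedSum-*ˡ : ∀ (cs : List (ℚ × VSet n)) a h →
    weightedSum cs (λ S → a *ℚ h S) ≡ a *ℚ weightedSum cs h
  weightedSum-*ˡ []             a h = sym (*-zeroʳ a)
  weightedSum-*ˡ ((l , S) ∷ cs) a h rewrite weightedSum-*ˡ cs a h =
    solve 4 (λ l a b c → l :* (a :* b) :+ a :* c := a :* (l :* b :+ c)) refl l a (h S) (weightedSum cs h)

  weightedSum-const : ∀ (cs : List (ℚ × VSet n)) a → weightedSum cs (λ _ → a) ≡ weightSum cs *ℚ a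
  weightedSum-const []             a = sym (*-zeroˡ a)
  weightedSum-const ((l , S) ∷ cs) a rewrite weightedSum-const cs a = sym (*-distribʳ-+ a l (weightSum cs))

  weightedSum-const-sub : ∀ (cs : List (ℚ × VSet n)) a h →
    weightedSum cs (λ S → a -ℚ h S) ≡ weightSum cs *ℚ a -ℚ weightedSum cs h
  weightedSum-const-sub []             a h = sym (trans (cong (_-ℚ 0ℚ) (*-zeroˡ a)) (+-inverseʳ 0ℚ))
  weightedSum-const-sub ((l , S) ∷ cs) a h rewrite weightedSum-const-sub cs a h =
    solve 5 (λ l a b w s → l :* (a :- b) :+ (w :* a :- s) := (l :+ w) :* a :- (l :* b :+ s))
      refl l a (h S) (weightSum cs) (weightedSum cs h)

  weightedSum-zero : ∀ (cs : List (ℚ × VSet n)) → weightedSum cs (λ _ → 0ℚ) ≡ 0ℚ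
  weightedSum-zero cs = trans (weightedSum-const cs 0ℚ) (*-zeroʳ (weightSum cs))

  Σℚ-weightedSum : ∀ {m} (cs : List (ℚ × VSet n)) (h : Fin m → VSet n → ℚ) →
    Σℚ (λ i → weightedSum cs (h i)) ≡ weightedSum cs (λ S → Σℚ (λ i → h i S))
  Σℚ-weightedSum {zero}  cs h = sym (weightedSum-zero cs)
  Σℚ-weightedSum {suc m} cs h =
    trans (cong (weightedSum cs (h zero) +ℚ_) (Σℚ-weightedSum cs (λ i → h (suc i))))
          (sym (weightedSum-+ cs (h zero) _))

  module _ {G : Graph n} where

    weightedSum-mono-≤ : ∀ {cs} → AllStableNonneg G cs → ∀ {h h′} →
      (∀ S → Stable G S → h S ≤ℚ h′ S) → weightedSum cs h ≤ℚ weightedSum cs h′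
    weightedSum-mono-≤ {[]}           _                   _    = ≤-refl
    weightedSum-mono-≤ {(l , S) ∷ cs} (0≤l , stable , cs-ok) h≤h′ =
      +-mono-≤ (*-monoˡ-≤-nonNeg l {{ℚ.nonNegative 0≤l}} (h≤h′ S stable)) (weightedSum-mono-≤ cs-ok h≤h′)

    weightedSum-≤ : ∀ {cs} → AllStableNonneg G cs → ∀ {h B} →
      (∀ S → Stable G S → h S ≤ℚ B) → weightedSum cs h ≤ℚ weightSum cs *ℚ B
    weightedSum-≤ {cs} ok {B = B} h≤B =
      ≤-trans (weightedSum-mono-≤ ok h≤B) (≤-reflexive (weightedSum-const cs B))

    weightedSum-+-member-≤ : ∀ {cs} → AllStableNonneg G cs → ∀ {h B l S} →
      (∀ S′ → Stable G S′ → h S′ ≤ℚ B) → (l , S) ∈ cs → h S ≡ 0ℚ →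
      weightedSum cs h +ℚ l *ℚ B ≤ℚ weightSum cs *ℚ B
    weightedSum-+-member-≤ {(l , S) ∷ cs} (_ , _ , cs-ok) {h} {B} h≤B (here refl) hS≡0 = begin
      l *ℚ h S +ℚ weightedSum cs h +ℚ l *ℚ B  ≡⟨ cong (λ a → l *ℚ a +ℚ weightedSum cs h +ℚ l *ℚ B) hS≡0 ⟩
      l *ℚ 0ℚ +ℚ weightedSum cs h +ℚ l *ℚ B   ≡⟨ solve 3 (λ l s b → l :* con 0ℚ :+ s :+ l :* b := l :* b :+ s)
                                                    refl l (weightedSum cs h) B ⟩
      l *ℚ B +ℚ weightedSum cs h              ≤⟨ +-monoʳ-≤ (l *ℚ B) (weightedSum-≤ cs-ok h≤B) ⟩
      l *ℚ B +ℚ weightSum cs *ℚ B             ≡⟨ sym (*-distribʳ-+ B l (weightSum cs)) ⟩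
      (l +ℚ weightSum cs) *ℚ B                ∎
      where open ≤-Reasoning
    weightedSum-+-member-≤ {(l′ , S′) ∷ cs} (0≤l′ , stable , cs-ok) {h} {B} {l} h≤B (there l,S∈cs) hS≡0 = begin
      l′ *ℚ h S′ +ℚ weightedSum cs h +ℚ l *ℚ B    ≡⟨ +-assoc (l′ *ℚ h S′) _ _ ⟩
      l′ *ℚ h S′ +ℚ (weightedSum cs h +ℚ l *ℚ B)
        ≤⟨ +-mono-≤ (*-monoˡ-≤-nonNeg l′ {{ℚ.nonNegative 0≤l′}} (h≤B S′ stable))
                    (weightedSum-+-member-≤ cs-ok h≤B l,S∈cs hS≡0) ⟩
      l′ *ℚ B +ℚ weightSum cs *ℚ B                ≡⟨ sym (*-distribʳ-+ B l′ (weightSum cs)) ⟩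
      (l′ +ℚ weightSum cs) *ℚ B                   ∎
      where open ≤-Reasoning

    member-stable : ∀ {cs l S} → AllStableNonneg G cs → (l , S) ∈ cs → Stable G S
    member-stable (_ , stable , _)     (here refl)   = stable
    member-stable (_ , _      , cs-ok) (there l,S∈cs) = member-stable cs-ok l,S∈cs

    positiveWeight : ∀ {cs} → AllStableNonneg G cs → 0ℚ <ℚ weightSum cs →
      ∃₂ λ l S → (l , S) ∈ cs × 0ℚ <ℚ l
    positiveWeight {[]} _ 0<0 = contradiction 0<0 (<-irrefl refl)
    positiveWeight {(l , S) ∷ cs} (0≤l , _ , cs-ok) 0<l+w with 0ℚ <? l
    ... | yes 0<l = l , S , here refl , 0<l
    ... | no  0≮l = inTail (positiveWeight cs-ok 0<w)
      where
      inTail : (∃₂ λ l′ S′ → (l′ , S′) ∈ cs × 0ℚ <ℚ l′) → ∃₂ λ l′ S′ → (l′ , S′) ∈ (l , S) ∷ cs × 0ℚ <ℚ l′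
      inTail (l′ , S′ , l′,S′∈cs , 0<l′) = l′ , S′ , there l′,S′∈cs , 0<l′

      0<w : 0ℚ <ℚ weightSum cs
      0<w = <-≤-trans 0<l+w (≤-reflexive (trans (cong (_+ℚ weightSum cs) (≤-antisym (≮⇒≥ 0≮l) 0≤l))
                                              (+-identityˡ (weightSum cs))))

χ-cong : ∀ {m n} (S : VSet m) (T : VSet n) {u v} → S u ≡ T v → χ S u ≡ χ T v
χ-cong S T {u} {v} eq with S u | T v
... | true  | true  = refl
... | false | false = refl
... | true  | false = contradiction eq λ ()
... | false | true  = contradiction eq λ ()

χ-true : ∀ {n} (S : VSet n) {v} → S v ≡ true → χ S v ≡ 1ℚ
χ-true S {v} = χ-cong S (λ (_ : Fin 1) → true) {v = zero}

χ-false : ∀ {n} (S : VSet n) {v} → S v ≡ false → χ S v ≡ 0ℚ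
χ-false S {v} = χ-cong S (λ (_ : Fin 1) → false) {v = zero}

module _ {n : ℕ} {G : Graph n} where

  χ-nonNeg : ∀ (S : VSet n) v → 0ℚ ≤ℚ χ S v
  χ-nonNeg S v with S v
  ... | true  = 0≤1
  ... | false = ≤-refl

  χ-edgeBounded : ∀ {S} → Stable G S → EdgeBounded G (χ S)
  χ-edgeBounded {S} stable u v uv with S u in Su | S v in Sv
  ... | true  | true  = contradiction (Su , Sv) (stable u v uv)
  ... | true  | false = ≤-reflexive (+-identityʳ 1ℚ)
  ... | false | true  = ≤-reflexive (+-identityˡ 1ℚ)
  ... | false | false = 0≤1

  stable-oddCycle-bound : ∀ {S} → Stable G S → (C : OddCycle G) →
    Σℚ (λ i → χ S (vert C i)) ≤ℚ fromℕℚ (suc (j C))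
  stable-oddCycle-bound {S} stable C =
    oddCycle-bound {f = χ S} (χ-edgeBounded stable) C (proj₁ outside) (χ-false S (proj₂ outside))
    where
    outside : ∃ λ p → S (vert C p) ≡ false
    outside with S (vert C zero) in S₀
    ... | false = zero , S₀
    ... | true  = next zero , Boolₚ.¬-not (λ S₁ → stable _ _ (adj-next C zero) (S₀ , S₁))

  STAB⊆TSTAB : ∀ {x} → InSTAB G x → InTSTAB G x
  STAB⊆TSTAB {x} (cs , ok , total , cs≗x) = nonNeg , edges , cycles
    where
    x≡ : ∀ v → x v ≡ weightedSum cs (λ S → χ S v)
    x≡ v = trans (sym (cs≗x v)) (combo≡weightedSum cs v)

    upper : ∀ {h B} → (∀ S → Stable G S → h S ≤ℚ B) → weightedSum cs h ≤ℚ B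
    upper {B = B} h≤B =
      ≤-trans (weightedSum-≤ ok h≤B) (≤-reflexive (trans (cong (_*ℚ B) total) (*-identityˡ B)))

    nonNeg : ∀ v → 0ℚ ≤ℚ x v
    nonNeg v = begin
      0ℚ                               ≡⟨ sym (weightedSum-zero cs) ⟩
      weightedSum cs (λ _ → 0ℚ)        ≤⟨ weightedSum-mono-≤ ok (λ S _ → χ-nonNeg S v) ⟩
      weightedSum cs (λ S → χ S v)     ≡⟨ sym (x≡ v) ⟩
      x v                              ∎
      where open ≤-Reasoning

    edges : EdgeBounded G x
    edges u v uv = begin
      x u +ℚ x v                                              ≡⟨ cong₂ _+ℚ_ (x≡ u) (x≡ v) ⟩
      weightedSum cs (λ S → χ S u) +ℚ weightedSum cs (λ S → χ S v)  ≡⟨ sym (weightedSum-+ cs _ _) ⟩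
      weightedSum cs (λ S → χ S u +ℚ χ S v)                   ≤⟨ upper (λ S stable → χ-edgeBounded stable u v uv) ⟩
      1ℚ                                                      ∎
      where open ≤-Reasoning

    cycles : ∀ C → Σℚ (λ i → x (vert C i)) ≤ℚ fromℕℚ (suc (j C))
    cycles C = begin
      Σℚ (λ i → x (vert C i))                            ≡⟨ Σℚ-cong (λ i → x≡ (vert C i)) ⟩
      Σℚ (λ i → weightedSum cs (λ S → χ S (vert C i)))   ≡⟨ Σℚ-weightedSum cs (λ i S → χ S (vert C i)) ⟩
      weightedSum cs (λ S → Σℚ (λ i → χ S (vert C i)))   ≤⟨ upper (λ S stable → stable-oddCycle-bound stable C) ⟩
      fromℕℚ (suc (j C))                                 ∎
      where open ≤-Reasoning

  CycleIn : VSet n → OddCycle G → Set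
  CycleIn W C = ∀ p → W (vert C p) ≡ true

  cycleIn-or-leaves : ∀ (W : VSet n) C → CycleIn W C ⊎ ∃ λ p → W (vert C p) ≡ false
  cycleIn-or-leaves W C with Finₚ.all? (λ p → W (vert C p) Bool.≟ true)
  ... | yes C⊆W = inj₁ C⊆W
  ... | no  C⊈W = inj₂ (map₂ Boolₚ.¬-not (Finₚ.¬∀⟶∃¬ _ _ (λ p → W (vert C p) Bool.≟ true) C⊈W))

  InTSTAB-fromSupport : ∀ {W x} → (∀ v → 0ℚ ≤ℚ x v) → EdgeBounded G x →
    (∀ v → W v ≡ false → x v ≡ 0ℚ) →
    (∀ C → CycleIn W C → Σℚ (λ i → x (vert C i)) ≤ℚ fromℕℚ (suc (j C))) → InTSTAB G x
  InTSTAB-fromSupport {W} {x} nonNeg edges x-off cyclesIn = nonNeg , edges , λ C →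
    [ cyclesIn C , (λ { (p , Wp≡false) → oddCycle-bound {f = x} edges C p (x-off (vert C p) Wp≡false) }) ]′
      (cycleIn-or-leaves W C)

-- Stable sets meeting all shortest odd cycles

oddLength : ℕ → ℕ
oddLength j = suc (suc (suc (j + j)))

module _ (i : ℕ) where

  private
    D : ℚ
    D = fromℕℚ (oddLength i)

    instance
      D-positive : ℚ.Positive D
      D-positive = ℚ.positive (fromℕℚ-pos (suc (suc (i + i))))

      D-nonZero : ℚ.NonZero D
      D-nonZero = ℚ.>-nonZero (fromℕℚ-pos (suc (suc (i + i))))

  opaque
    -- The constant weight (i + 1)/(2i + 3) makes the odd cycles of length 2i + 3 tight.
    cycleWeight : ℚ
    cycleWeight = fromℕℚ (suc i) *ℚ 1/ D

    oddLength*cycleWeight : D *ℚ cycleWeight ≡ fromℕℚ (suc i)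
    oddLength*cycleWeight = begin
      D *ℚ (fromℕℚ (suc i) *ℚ 1/ D)  ≡⟨ solve 3 (λ d b e → d :* (b :* e) := b :* (d :* e))
                                               refl D (fromℕℚ (suc i)) (1/ D) ⟩
      fromℕℚ (suc i) *ℚ (D *ℚ 1/ D)  ≡⟨ cong (fromℕℚ (suc i) *ℚ_) (*-inverseʳ D) ⟩
      fromℕℚ (suc i) *ℚ 1ℚ           ≡⟨ *-identityʳ (fromℕℚ (suc i)) ⟩
      fromℕℚ (suc i)                 ∎
      where open ≡-Reasoning

  private
    w : ℚ
    w = cycleWeight

  cycleWeight-nonNeg : 0ℚ ≤ℚ w
  cycleWeight-nonNeg = *-cancelˡ-≤-pos D (begin
    D *ℚ 0ℚ         ≡⟨ *-zeroʳ D ⟩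
    0ℚ              ≤⟨ fromℕℚ-nonNeg (suc i) ⟩
    fromℕℚ (suc i)  ≡⟨ sym oddLength*cycleWeight ⟩
    D *ℚ w          ∎)
    where open ≤-Reasoning

  cycleWeight-edge : w +ℚ w ≤ℚ 1ℚ
  cycleWeight-edge = *-cancelˡ-≤-pos D (begin
    D *ℚ (w +ℚ w)                     ≡⟨ *-distribˡ-+ D w w ⟩
    D *ℚ w +ℚ D *ℚ w                  ≡⟨ cong₂ _+ℚ_ oddLength*cycleWeight oddLength*cycleWeight ⟩
    fromℕℚ (suc i) +ℚ fromℕℚ (suc i)  ≡⟨ sym (fromℕℚ-+ (suc i) (suc i)) ⟩
    fromℕℚ (suc i + suc i)            ≤⟨ fromℕℚ-mono-≤ (ℕₚ.≤-trans (ℕₚ.≤-reflexive (ℕₚ.+-suc (suc i) i))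
                                                                   (ℕₚ.n≤1+n _)) ⟩
    D                                 ≡⟨ sym (*-identityʳ D) ⟩
    D *ℚ 1ℚ                           ∎)
    where open ≤-Reasoning

  cycleWeight-cycle : ∀ {j} → i ≤ j → fromℕℚ (oddLength j) *ℚ w ≤ℚ fromℕℚ (suc j)
  cycleWeight-cycle {j} i≤j = *-cancelˡ-≤-pos D (begin
    D *ℚ (L *ℚ w)                        ≡⟨ solve 3 (λ d l a → d :* (l :* a) := l :* (d :* a)) refl D L w ⟩
    L *ℚ (D *ℚ w)                        ≡⟨ cong (L *ℚ_) oddLength*cycleWeight ⟩
    L *ℚ fromℕℚ (suc i)                  ≡⟨ sym (fromℕℚ-* (oddLength j) (suc i)) ⟩
    fromℕℚ (oddLength j ℕ.* suc i)       ≤⟨ fromℕℚ-mono-≤ (cross-multiplied i≤j) ⟩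
    fromℕℚ (suc j ℕ.* oddLength i)       ≡⟨ fromℕℚ-* (suc j) (oddLength i) ⟩
    fromℕℚ (suc j) *ℚ D                  ≡⟨ *-comm (fromℕℚ (suc j)) D ⟩
    D *ℚ fromℕℚ (suc j)                  ∎)
    where
    open ≤-Reasoning
    L : ℚ
    L = fromℕℚ (oddLength j)
    -- With j = i + d the two sides differ by exactly d.
    difference : ∀ i d → (3 + ((i + d) + (i + d))) ℕ.* (1 + i) + d ≡ (1 + (i + d)) ℕ.* (3 + (i + i))
    difference = solve-∀
    cross-multiplied : i ≤ j → oddLength j ℕ.* suc i ≤ suc j ℕ.* oddLength i
    cross-multiplied i≤j with ℕₚ.m≤n⇒∃[o]m+o≡n i≤j
    ... | d , refl = ℕₚ.≤-trans (ℕₚ.m≤m+n _ d) (ℕₚ.≤-reflexive (difference i d))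

module _ {n : ℕ} {G : Graph n} where

  Misses : VSet n → OddCycle G → Set
  Misses S C = ∀ p → S (vert C p) ≡ false

  -- Complementary slackness: a stable set of positive weight attains the tight
  -- inequality of C, so it meets C.
  positiveWeight-meets-tight : ∀ {x : Fin n → ℚ} {cs} → AllStableNonneg G cs → weightSum cs ≡ 1ℚ →
    (∀ v → combo cs v ≡ x v) → ∀ {l S} → (l , S) ∈ cs → 0ℚ <ℚ l →
    ∀ C → Σℚ (λ p → x (vert C p)) ≡ fromℕℚ (suc (j C)) → ¬ Misses S C
  positiveWeight-meets-tight {x} {cs} ok total cs≗x {l} {S} l,S∈cs 0<l C tight misses =
    <-irrefl refl (begin-strict
      B                           ≡⟨ sym (+-identityʳ B) ⟩
      B +ℚ 0ℚ                     <⟨ +-monoʳ-< B 0<lB ⟩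
      B +ℚ l *ℚ B                 ≡⟨ cong (_+ℚ l *ℚ B) (sym average≡B) ⟩
      weightedSum cs h +ℚ l *ℚ B  ≤⟨ weightedSum-+-member-≤ ok (λ _ stable → stable-oddCycle-bound stable C)
                                       l,S∈cs hS≡0 ⟩
      weightSum cs *ℚ B           ≡⟨ trans (cong (_*ℚ B) total) (*-identityˡ B) ⟩
      B                           ∎)
    where
    open ≤-Reasoning
    B : ℚ
    B = fromℕℚ (suc (j C))

    h : VSet n → ℚ
    h T = Σℚ (λ p → χ T (vert C p))

    hS≡0 : h S ≡ 0ℚ
    hS≡0 = trans (Σℚ-cong (λ p → χ-false S (misses p)))
                 (trans (Σℚ-const {length C} 0ℚ) (*-zeroʳ (fromℕℚ (length C))))

    average≡B : weightedSum cs h ≡ B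
    average≡B = begin-equality
      weightedSum cs h                                  ≡⟨ sym (Σℚ-weightedSum cs (λ p T → χ T (vert C p))) ⟩
      Σℚ (λ p → weightedSum cs (λ T → χ T (vert C p)))  ≡⟨ Σℚ-cong (λ p → trans (sym (combo≡weightedSum cs _))
                                                                                 (cs≗x (vert C p))) ⟩
      Σℚ (λ p → x (vert C p))                           ≡⟨ tight ⟩
      B                                                 ∎

    0<lB : 0ℚ <ℚ l *ℚ B
    0<lB = ≤-<-trans (≤-reflexive (sym (*-zeroˡ B))) (*-monoˡ-<-pos B {{ℚ.positive (fromℕℚ-pos (j C))}} 0<l)

  hittingStableSet : TPerfect G → ∀ W i → (∀ C → CycleIn W C → i ≤ j C) →
    ∃ λ S → Stable G S × (∀ C → CycleIn W C → j C ≡ i → ¬ Misses S C)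
  hittingStableSet perfect W i long = fromDecomposition (proj₂ (perfect x) x-TSTAB)
    where
    w : ℚ
    w = cycleWeight i

    x : Fin n → ℚ
    x v = if W v then w else 0ℚ

    x≤w : ∀ v → x v ≤ℚ w
    x≤w v with W v
    ... | true  = ≤-refl
    ... | false = cycleWeight-nonNeg i

    x-nonNeg : ∀ v → 0ℚ ≤ℚ x v
    x-nonNeg v with W v
    ... | true  = cycleWeight-nonNeg i
    ... | false = ≤-refl

    x-onCycle : ∀ C → CycleIn W C → Σℚ (λ p → x (vert C p)) ≡ fromℕℚ (length C) *ℚ w
    x-onCycle C C⊆W = trans (Σℚ-cong (λ p → cong (if_then w else 0ℚ) (C⊆W p))) (Σℚ-const {length C} w)

    x-TSTAB : InTSTAB G x
    x-TSTAB = InTSTAB-fromSupport x-nonNeg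
      (λ u v _ → ≤-trans (+-mono-≤ (x≤w u) (x≤w v)) (cycleWeight-edge i))
      (λ v Wv≡false → cong (if_then w else 0ℚ) Wv≡false)
      (λ C C⊆W → ≤-trans (≤-reflexive (x-onCycle C C⊆W)) (cycleWeight-cycle i (long C C⊆W)))

    tight : ∀ C → CycleIn W C → j C ≡ i → Σℚ (λ p → x (vert C p)) ≡ fromℕℚ (suc (j C))
    tight C C⊆W j≡i = trans (x-onCycle C C⊆W)
      (subst (λ k → fromℕℚ (oddLength k) *ℚ w ≡ fromℕℚ (suc k)) (sym j≡i) (oddLength*cycleWeight i))

    fromDecomposition : InSTAB G x → ∃ λ S → Stable G S × (∀ C → CycleIn W C → j C ≡ i → ¬ Misses S C)
    fromDecomposition (cs , ok , total , cs≗x)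
      with positiveWeight ok (<-≤-trans (positive⁻¹ 1ℚ) (≤-reflexive (sym total)))
    ... | l , S , l,S∈cs , 0<l = S , member-stable ok l,S∈cs , λ C C⊆W j≡i →
      positiveWeight-meets-tight {x = x} ok total cs≗x l,S∈cs 0<l C (tight C C⊆W j≡i)

record Peeling {n : ℕ} (G : Graph n) (i : ℕ) : Set where
  field
    layer        : Fin i → VSet n
    layer-stable : ∀ b → Stable G (layer b)
    rest         : VSet n
    covered      : ∀ v → rest v ≡ true ⊎ ∃ λ b → layer b v ≡ true
    rest-long    : ∀ (C : OddCycle G) → CycleIn rest C → i ≤ j C
open Peeling

module _ {n : ℕ} {G : Graph n} where

  addLayer : ∀ {i} (P : Peeling G i) →
    (∃ λ S → Stable G S × (∀ C → CycleIn (rest P) C → j C ≡ i → ¬ Misses S C)) → Peeling G (suc i)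
  addLayer {i} P (S , S-stable , S-hits) = record
    { layer        = layer′
    ; layer-stable = λ { zero → S-stable ; (suc b) → layer-stable P b }
    ; rest         = rest′
    ; covered      = covered′
    ; rest-long    = rest′-long
    }
    where
    layer′ : Fin (suc i) → VSet n
    layer′ zero    = S
    layer′ (suc b) = layer P b

    rest′ : VSet n
    rest′ v = rest P v ∧ not (S v)

    covered′ : ∀ v → rest′ v ≡ true ⊎ ∃ λ b → layer′ b v ≡ true
    covered′ v with rest P v in restv | S v in Sv
    ... | _     | true  = inj₂ (zero , Sv)
    ... | true  | false = inj₁ refl
    ... | false | false = [ (λ restv′ → contradiction (trans (sym restv) restv′) λ ())
                          , (λ { (b , e) → inj₂ (suc b , e) }) ]′ (covered P v)

    rest′-long : ∀ C → CycleIn rest′ C → suc i ≤ j C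
    rest′-long C C⊆rest′ = ℕₚ.≤∧≢⇒< (rest-long P C C⊆rest) (λ i≡j → S-hits C C⊆rest (sym i≡j) misses)
      where
      C⊆rest : CycleIn (rest P) C
      C⊆rest p = Boolₚ.∧-conicalˡ _ _ (C⊆rest′ p)
      misses : Misses S C
      misses p = Boolₚ.not-injective (Boolₚ.∧-conicalʳ _ _ (C⊆rest′ p))

  peel : TPerfect G → ∀ i → Peeling G i
  peel perfect zero    = record
    { layer        = λ ()
    ; layer-stable = λ ()
    ; rest         = λ _ → true
    ; covered      = λ _ → inj₁ refl
    ; rest-long    = λ _ _ → z≤n
    }
  peel perfect (suc i) = addLayer P (hittingStableSet perfect (rest P) i (rest-long P))
    where
    P : Peeling G i
    P = peel perfect i

-- Pendant vertices

ratio : ∀ {t β} → 0ℚ ≤ℚ t → t ≤ℚ β → ∃ λ r → 0ℚ ≤ℚ r × r ≤ℚ 1ℚ × r *ℚ β ≡ t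
ratio {t} {β} 0≤t t≤β with 0ℚ <? β
... | no  0≮β = 0ℚ , ≤-refl , 0≤1 , trans (*-zeroˡ β) (≤-antisym 0≤t (≤-trans t≤β (≮⇒≥ 0≮β)))
... | yes 0<β = r , 0≤r , r≤1 , trans (*-comm r β) β*r≡t
  where
  instance
    β-nonZero : ℚ.NonZero β
    β-nonZero = ℚ.>-nonZero 0<β

    β-positive : ℚ.Positive β
    β-positive = ℚ.positive 0<β

  r : ℚ
  r = t *ℚ 1/ β

  β*r≡t : β *ℚ r ≡ t
  β*r≡t = begin
    β *ℚ (t *ℚ 1/ β)  ≡⟨ solve 3 (λ b t e → b :* (t :* e) := t :* (b :* e)) refl β t (1/ β) ⟩
    t *ℚ (β *ℚ 1/ β)  ≡⟨ cong (t *ℚ_) (*-inverseʳ β) ⟩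
    t *ℚ 1ℚ           ≡⟨ *-identityʳ t ⟩
    t                 ∎
    where open ≡-Reasoning

  0≤r : 0ℚ ≤ℚ r
  0≤r = *-cancelˡ-≤-pos β (≤-trans (≤-reflexive (*-zeroʳ β)) (≤-trans 0≤t (≤-reflexive (sym β*r≡t))))

  r≤1 : r ≤ℚ 1ℚ
  r≤1 = *-cancelˡ-≤-pos β (≤-trans (≤-reflexive β*r≡t) (≤-trans t≤β (≤-reflexive (sym (*-identityʳ β)))))

module _ {m : ℕ} {H : Graph m} where

  InSTAB-resp : ∀ {x y} → (∀ v → x v ≡ y v) → InSTAB H x → InSTAB H y
  InSTAB-resp x≗y (cs , ok , total , cs≗x) = cs , ok , total , λ v → trans (cs≗x v) (x≗y v)

  refine : ℚ → (VSet m → VSet m) → (VSet m → VSet m) → List (ℚ × VSet m) → List (ℚ × VSet m)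
  refine r f g []             = []
  refine r f g ((l , S) ∷ cs) = (r *ℚ l , f S) ∷ ((1ℚ -ℚ r) *ℚ l , g S) ∷ refine r f g cs

  weightSum-refine : ∀ r f g cs → weightSum (refine r f g cs) ≡ weightSum cs
  weightSum-refine r f g []             = refl
  weightSum-refine r f g ((l , S) ∷ cs) rewrite weightSum-refine r f g cs =
    solve 3 (λ r l w → r :* l :+ ((con 1ℚ :- r) :* l :+ w) := l :+ w) refl r l (weightSum cs)

  weightedSum-refine : ∀ r f g cs h → weightedSum (refine r f g cs) h ≡
    weightedSum cs (λ S → r *ℚ h (f S) +ℚ (1ℚ -ℚ r) *ℚ h (g S))
  weightedSum-refine r f g []             h = refl
  weightedSum-refine r f g ((l , S) ∷ cs) h rewrite weightedSum-refine r f g cs h =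
    solve 5 (λ r l a b w → r :* l :* a :+ ((con 1ℚ :- r) :* l :* b :+ w)
                         := l :* (r :* a :+ (con 1ℚ :- r) :* b) :+ w)
      refl r l (h (f S)) (h (g S)) (weightedSum cs _)

  refine-AllStableNonneg : ∀ {r f g} → 0ℚ ≤ℚ r → r ≤ℚ 1ℚ →
    (∀ S → Stable H S → Stable H (f S)) → (∀ S → Stable H S → Stable H (g S)) →
    ∀ cs → AllStableNonneg H cs → AllStableNonneg H (refine r f g cs)
  refine-AllStableNonneg {r} 0≤r r≤1 f-stable g-stable [] _ = _
  refine-AllStableNonneg {r} 0≤r r≤1 f-stable g-stable ((l , S) ∷ cs) (0≤l , stable , cs-ok) =
    nonNeg-* 0≤r 0≤l , f-stable S stable ,
    nonNeg-* 0≤1-r 0≤l , g-stable S stable ,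
    refine-AllStableNonneg 0≤r r≤1 f-stable g-stable cs cs-ok
    where
    nonNeg-* : ∀ {a b} → 0ℚ ≤ℚ a → 0ℚ ≤ℚ b → 0ℚ ≤ℚ a *ℚ b
    nonNeg-* {a} {b} 0≤a 0≤b =
      nonNegative⁻¹ (a *ℚ b) {{nonNeg*nonNeg⇒nonNeg a {{ℚ.nonNegative 0≤a}} b {{ℚ.nonNegative 0≤b}}}}

    0≤1-r : 0ℚ ≤ℚ 1ℚ -ℚ r
    0≤1-r = ≤-trans (≤-reflexive (sym (+-inverseʳ r))) (+-monoˡ-≤ (ℚ.- r) r≤1)

  Stable-⊆ : ∀ {S T} → Stable H S → (∀ v → T v ≡ true → S v ≡ true) → Stable H T
  Stable-⊆ stable T⊆S a b ab (Ta , Tb) = stable a b ab (T⊆S a Ta , T⊆S b Tb)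

  Stable-remove : ∀ {S} w → Stable H S → Stable H (updateAt S w (λ _ → false))
  Stable-remove {S} w stable = Stable-⊆ stable S-w⊆S
    where
    S-w⊆S : ∀ v → updateAt S w (λ _ → false) v ≡ true → S v ≡ true
    S-w⊆S v eq with v Fin.≟ w
    ... | yes refl = contradiction (trans (sym (updateAt-updates w S)) eq) λ ()
    ... | no  v≢w  = trans (sym (updateAt-minimal v w S v≢w)) eq

  Stable-add : ∀ {S} w → Stable H S → (∀ z → Adj H w z → S z ≡ false) →
    Stable H (updateAt S w (λ _ → true))
  Stable-add {S} w stable outside a b ab (Ta , Tb) with a Fin.≟ w | b Fin.≟ w
  ... | yes refl | yes refl = irrefl H ab
  ... | yes refl | no  b≢w  = Boolₚ.not-¬ (outside b ab) (trans (sym (updateAt-minimal b w S b≢w)) Tb)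
  ... | no  a≢w  | yes refl =
    Boolₚ.not-¬ (outside a (Graph.sym H ab)) (trans (sym (updateAt-minimal a w S a≢w)) Ta)
  ... | no  a≢w  | no  b≢w  =
    stable a b ab (trans (sym (updateAt-minimal a w S a≢w)) Ta , trans (sym (updateAt-minimal b w S b≢w)) Tb)

  module _ {w u : Fin m} (pendant : ∀ z → Adj H w z → z ≡ u) where

    toggle : VSet m → VSet m
    toggle S = updateAt S w (λ _ → not (S u))

    drop : VSet m → VSet m
    drop S = updateAt S w (λ _ → false)

    Stable-toggle : ∀ {S} → Stable H S → Stable H (toggle S)
    Stable-toggle {S} stable with S u in Su
    ... | true  = Stable-remove w stable
    ... | false = Stable-add w stable (λ z wz → trans (cong S (pendant z wz)) Su)

    χ-toggle : ∀ S → χ (toggle S) w ≡ 1ℚ -ℚ χ S u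
    χ-toggle S with S u
    ... | true  = trans (χ-false (updateAt S w (λ _ → false)) (updateAt-updates w S)) (sym (+-inverseʳ 1ℚ))
    ... | false = χ-true (updateAt S w (λ _ → true)) (updateAt-updates w S)

    combo-refine : ∀ r cs z → combo (refine r toggle drop cs) z ≡
      weightedSum cs (λ S → r *ℚ χ (toggle S) z +ℚ (1ℚ -ℚ r) *ℚ χ (drop S) z)
    combo-refine r cs z =
      trans (combo≡weightedSum (refine r toggle drop cs) z) (weightedSum-refine r toggle drop cs (λ S → χ S z))

    combo-refine-away : ∀ r cs {z} → z ≢ w → combo (refine r toggle drop cs) z ≡ combo cs z
    combo-refine-away r cs {z} z≢w = begin
      combo (refine r toggle drop cs) z                                         ≡⟨ combo-refine r cs z ⟩
      weightedSum cs (λ S → r *ℚ χ (toggle S) z +ℚ (1ℚ -ℚ r) *ℚ χ (drop S) z)  ≡⟨ weightedSum-cong cs unchanged ⟩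
      weightedSum cs (λ S → χ S z)                                              ≡⟨ sym (combo≡weightedSum cs z) ⟩
      combo cs z                                                                ∎
      where
      open ≡-Reasoning
      unchanged : ∀ S → r *ℚ χ (toggle S) z +ℚ (1ℚ -ℚ r) *ℚ χ (drop S) z ≡ χ S z
      unchanged S = begin
        r *ℚ χ (toggle S) z +ℚ (1ℚ -ℚ r) *ℚ χ (drop S) z
          ≡⟨ cong₂ (λ a b → r *ℚ a +ℚ (1ℚ -ℚ r) *ℚ b) (χ-cong (toggle S) S (updateAt-minimal z w S z≢w))
                                                     (χ-cong (drop S) S (updateAt-minimal z w S z≢w)) ⟩
        r *ℚ χ S z +ℚ (1ℚ -ℚ r) *ℚ χ S z
          ≡⟨ solve 2 (λ r a → r :* a :+ (con 1ℚ :- r) :* a := a) refl r (χ S z) ⟩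
        χ S z ∎

    combo-refine-at : ∀ r cs → weightSum cs ≡ 1ℚ →
      combo (refine r toggle drop cs) w ≡ r *ℚ (1ℚ -ℚ combo cs u)
    combo-refine-at r cs total = begin
      combo (refine r toggle drop cs) w                                         ≡⟨ combo-refine r cs w ⟩
      weightedSum cs (λ S → r *ℚ χ (toggle S) w +ℚ (1ℚ -ℚ r) *ℚ χ (drop S) w)  ≡⟨ weightedSum-cong cs atW ⟩
      weightedSum cs (λ S → r *ℚ (1ℚ -ℚ χ S u))                                 ≡⟨ weightedSum-*ˡ cs r _ ⟩
      r *ℚ weightedSum cs (λ S → 1ℚ -ℚ χ S u)            ≡⟨ cong (r *ℚ_) (weightedSum-const-sub cs 1ℚ _) ⟩
      r *ℚ (weightSum cs *ℚ 1ℚ -ℚ weightedSum cs (λ S → χ S u))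
                                                         ≡⟨ cong₂ (λ a b → r *ℚ (a *ℚ 1ℚ -ℚ b)) total
                                                                  (sym (combo≡weightedSum cs u)) ⟩
      r *ℚ (1ℚ -ℚ combo cs u)                            ∎
      where
      open ≡-Reasoning
      atW : ∀ S → r *ℚ χ (toggle S) w +ℚ (1ℚ -ℚ r) *ℚ χ (drop S) w ≡ r *ℚ (1ℚ -ℚ χ S u)
      atW S = begin
        r *ℚ χ (toggle S) w +ℚ (1ℚ -ℚ r) *ℚ χ (drop S) w
          ≡⟨ cong₂ (λ a b → r *ℚ a +ℚ (1ℚ -ℚ r) *ℚ b) (χ-toggle S) (χ-false (drop S) (updateAt-updates w S)) ⟩
        r *ℚ (1ℚ -ℚ χ S u) +ℚ (1ℚ -ℚ r) *ℚ 0ℚ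
          ≡⟨ solve 2 (λ r a → r :* (con 1ℚ :- a) :+ (con 1ℚ :- r) :* con 0ℚ := r :* (con 1ℚ :- a))
                     refl r (χ S u) ⟩
        r *ℚ (1ℚ -ℚ χ S u) ∎

    -- Put w into an r-fraction of every set avoiding u, with r (1 - x u) = t.
    extendPendant : ∀ {x} → InSTAB H x → ∀ t → 0ℚ ≤ℚ t → t +ℚ x u ≤ℚ 1ℚ →
      InSTAB H (updateAt x w (λ _ → t))
    extendPendant {x} (cs , ok , total , cs≗x) t 0≤t t+xu≤1 = extend (ratio 0≤t t≤1-xu)
      where
      t≤1-xu : t ≤ℚ 1ℚ -ℚ x u
      t≤1-xu = begin
        t                ≡⟨ solve 2 (λ t a → t := t :+ a :- a) refl t (x u) ⟩
        t +ℚ x u -ℚ x u  ≤⟨ +-monoˡ-≤ (ℚ.- x u) t+xu≤1 ⟩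
        1ℚ -ℚ x u        ∎
        where open ≤-Reasoning

      extend : (∃ λ r → 0ℚ ≤ℚ r × r ≤ℚ 1ℚ × r *ℚ (1ℚ -ℚ x u) ≡ t) → InSTAB H (updateAt x w (λ _ → t))
      extend (r , 0≤r , r≤1 , r*[1-xu]≡t) =
        refine r toggle drop cs ,
        refine-AllStableNonneg 0≤r r≤1 (λ _ → Stable-toggle) (λ _ → Stable-remove w) cs ok ,
        trans (weightSum-refine r toggle drop cs) total ,
        combo′
        where
        combo′ : ∀ z → combo (refine r toggle drop cs) z ≡ updateAt x w (λ _ → t) z
        combo′ z with z Fin.≟ w
        ... | no z≢w   = trans (combo-refine-away r cs z≢w) (trans (cs≗x z) (sym (updateAt-minimal z w x z≢w)))
        ... | yes refl = begin
          combo (refine r toggle drop cs) w  ≡⟨ combo-refine-at r cs total ⟩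
          r *ℚ (1ℚ -ℚ combo cs u)            ≡⟨ cong (λ a → r *ℚ (1ℚ -ℚ a)) (cs≗x u) ⟩
          r *ℚ (1ℚ -ℚ x u)                   ≡⟨ r*[1-xu]≡t ⟩
          t                                  ≡⟨ sym (updateAt-updates w x) ⟩
          updateAt x w (λ _ → t) w           ∎
          where open ≡-Reasoning

module _ {n : ℕ} {G : Graph n} where

  twoNeighbours : (C : OddCycle G) (p : Fin (length C)) →
    ∃₂ λ q q′ → q ≢ q′ × Adj G (vert C p) (vert C q) × Adj G (vert C p) (vert C q′)
  twoNeighbours C zero    = suc zero , fromℕ _ , (λ ()) , step C zero , Graph.sym G (close C)
  twoNeighbours C (suc i) with fromℕ-or-inject₁ i
  ... | inj₁ refl        = inject₁ i , zero , (λ ()) , Graph.sym G (step C i) , close C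
  ... | inj₂ (i′ , refl) =
    inject₁ (inject₁ i′) , suc (suc i′) , distinct , Graph.sym G (step C (inject₁ i′)) , step C (suc i′)
    where
    distinct : inject₁ (inject₁ i′) ≢ suc (suc i′)
    distinct eq = ℕₚ.m≢1+n+m (toℕ i′) {1}
      (trans (sym (trans (Finₚ.toℕ-inject₁ (inject₁ i′)) (Finₚ.toℕ-inject₁ i′))) (cong toℕ eq))

  oddCycle-noPendant : (C : OddCycle G) (p : Fin (length C)) (u : Fin n) →
    ¬ (∀ z → Adj G (vert C p) z → z ≡ u)
  oddCycle-noPendant C p u pendant with twoNeighbours C p
  ... | q , q′ , q≢q′ , pq , pq′ = q≢q′ (inj C (trans (pendant _ pq) (sym (pendant _ pq′))))

-- G[W] with a pendant vertex R v attached to every L v.  Vertices outside W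
-- thus become K₂ components rather than isolated vertices: an isolated vertex
-- has no inequality bounding it by 1 in TSTAB, so it would spoil t-perfection.
module Pendant {n : ℕ} (G : Graph n) (W : VSet n) where

  AdjLR : Fin n ⊎ Fin n → Fin n ⊎ Fin n → Set
  AdjLR (inj₁ u) (inj₁ v) = Adj G u v × W u ≡ true × W v ≡ true
  AdjLR (inj₁ u) (inj₂ v) = u ≡ v
  AdjLR (inj₂ u) (inj₁ v) = u ≡ v
  AdjLR (inj₂ _) (inj₂ _) = ⊥

  AdjLR-sym : ∀ a b → AdjLR a b → AdjLR b a
  AdjLR-sym (inj₁ u) (inj₁ v) (uv , Wu , Wv) = Graph.sym G uv , Wv , Wu
  AdjLR-sym (inj₁ u) (inj₂ v) u≡v = sym u≡v
  AdjLR-sym (inj₂ u) (inj₁ v) u≡v = sym u≡v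

  AdjLR-irrefl : ∀ a → ¬ AdjLR a a
  AdjLR-irrefl (inj₁ u) (uu , _) = irrefl G uu

  H : Graph (n + n)
  H = record
    { Adj    = λ a b → AdjLR (splitAt n a) (splitAt n b)
    ; sym    = λ {a} {b} → AdjLR-sym (splitAt n a) (splitAt n b)
    ; irrefl = λ {a} → AdjLR-irrefl (splitAt n a)
    }

  L R : Fin n → Fin (n + n)
  L v = v ↑ˡ n
  R v = n ↑ʳ v

  splitAt-L : ∀ v → splitAt n (L v) ≡ inj₁ v
  splitAt-L v = Finₚ.splitAt-↑ˡ n v n

  splitAt-R : ∀ v → splitAt n (R v) ≡ inj₂ v
  splitAt-R v = Finₚ.splitAt-↑ʳ n n v

  L-or-R : ∀ z → (∃ λ v → z ≡ L v) ⊎ (∃ λ v → z ≡ R v)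
  L-or-R z with splitAt n z in eq
  ... | inj₁ v = inj₁ (v , sym (Finₚ.splitAt⁻¹-↑ˡ eq))
  ... | inj₂ v = inj₂ (v , sym (Finₚ.splitAt⁻¹-↑ʳ eq))

  L-injective : ∀ {u v} → L u ≡ L v → u ≡ v
  L-injective = Finₚ.↑ˡ-injective n _ _

  R-injective : ∀ {u v} → R u ≡ R v → u ≡ v
  R-injective = Finₚ.↑ʳ-injective n _ _

  L≢R : ∀ u v → L u ≢ R v
  L≢R u v eq with () ← trans (sym (splitAt-L u)) (trans (cong (splitAt n) eq) (splitAt-R v))

  toAdjLR : ∀ {a b a′ b′} → splitAt n a ≡ a′ → splitAt n b ≡ b′ → Adj H a b → AdjLR a′ b′
  toAdjLR refl refl ab = ab

  fromAdjLR : ∀ {a b a′ b′} → splitAt n a ≡ a′ → splitAt n b ≡ b′ → AdjLR a′ b′ → Adj H a b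
  fromAdjLR refl refl ab = ab

  adj-LL : ∀ {u v} → Adj G u v → W u ≡ true → W v ≡ true → Adj H (L u) (L v)
  adj-LL uv Wu Wv = fromAdjLR (splitAt-L _) (splitAt-L _) (uv , Wu , Wv)

  adj-LL⁻ : ∀ {u v} → Adj H (L u) (L v) → Adj G u v
  adj-LL⁻ LuLv = proj₁ (toAdjLR (splitAt-L _) (splitAt-L _) LuLv)

  adj-LR : ∀ v → Adj H (L v) (R v)
  adj-LR v = fromAdjLR (splitAt-L v) (splitAt-R v) refl

  R-pendant : ∀ v z → Adj H (R v) z → z ≡ L v
  R-pendant v z Rvz with L-or-R z
  ... | inj₁ (u , refl) = cong L (sym (toAdjLR (splitAt-R v) (splitAt-L u) Rvz))
  ... | inj₂ (u , refl) = ⊥-elim (toAdjLR (splitAt-R v) (splitAt-R u) Rvz)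

  L-pendant : ∀ {v} → W v ≡ false → ∀ z → Adj H (L v) z → z ≡ R v
  L-pendant {v} Wv≡false z Lvz with L-or-R z
  ... | inj₁ (u , refl) =
    contradiction (proj₁ (proj₂ (toAdjLR (splitAt-L v) (splitAt-L u) Lvz))) (Boolₚ.not-¬ Wv≡false)
  ... | inj₂ (u , refl) = cong R (sym (toAdjLR (splitAt-L v) (splitAt-R u) Lvz))

  onCycle-L : (C : OddCycle H) (p : Fin (length C)) → ∃ λ v → vert C p ≡ L v × W v ≡ true
  onCycle-L C p = classify (L-or-R (vert C p))
    where
    notPendant : ∀ {a u} → vert C p ≡ a → ¬ (∀ z → Adj H a z → z ≡ u)
    notPendant refl = oddCycle-noPendant C p _

    classify : (∃ λ v → vert C p ≡ L v) ⊎ (∃ λ v → vert C p ≡ R v) → ∃ λ v → vert C p ≡ L v × W v ≡ true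
    classify (inj₂ (v , Cp≡Rv)) = ⊥-elim (notPendant Cp≡Rv (R-pendant v))
    classify (inj₁ (v , Cp≡Lv)) with W v in Wv
    ... | true  = v , Cp≡Lv , Wv
    ... | false = ⊥-elim (notPendant Cp≡Lv (L-pendant Wv))

  project : OddCycle H → OddCycle G
  project C = record { j = j C ; vert = vert′ ; inj = inj′ ; step = step′ ; close = close′ }
    where
    vert′ : Fin (length C) → Fin n
    vert′ p = proj₁ (onCycle-L C p)
    C≡L : ∀ p → vert C p ≡ L (vert′ p)
    C≡L p = proj₁ (proj₂ (onCycle-L C p))
    inj′ : ∀ {p q} → vert′ p ≡ vert′ q → p ≡ q
    inj′ {p} {q} eq = inj C (trans (C≡L p) (trans (cong L eq) (sym (C≡L q))))
    step′ : ∀ i → Adj G (vert′ (inject₁ i)) (vert′ (suc i))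
    step′ i = adj-LL⁻ (subst₂ (Adj H) (C≡L (inject₁ i)) (C≡L (suc i)) (step C i))
    close′ : Adj G (vert′ (fromℕ _)) (vert′ zero)
    close′ = adj-LL⁻ (subst₂ (Adj H) (C≡L (fromℕ _)) (C≡L zero) (close C))

  project-in-W : ∀ C → CycleIn W (project C)
  project-in-W C p = proj₂ (proj₂ (onCycle-L C p))

  noShortOddCycle : ∀ {k} → (∀ C → CycleIn W C → k ≤ j C) → NoShortOddCycle k H
  noShortOddCycle {k} long C short =
    contradiction short (ℕₚ.<⇒≱ (s≤s (s≤s (ℕₚ.m≤n⇒m≤1+n (ℕₚ.+-mono-≤ k≤j k≤j)))))
    where
    k≤j : k ≤ j C
    k≤j = long (project C) (project-in-W C)

  lift : (C : OddCycle G) → CycleIn W C → OddCycle H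
  lift C C⊆W = record
    { j     = j C
    ; vert  = L ∘ vert C
    ; inj   = inj C ∘ L-injective
    ; step  = λ i → adj-LL (step C i) (C⊆W _) (C⊆W _)
    ; close = adj-LL (close C) (C⊆W _) (C⊆W _)
    }

  liftSide : VSet n → Fin n ⊎ Fin n → Bool
  liftSide S (inj₁ v) = S v ∧ W v
  liftSide S (inj₂ _) = false

  liftSet : VSet n → VSet (n + n)
  liftSet S z = liftSide S (splitAt n z)

  liftSet-L : ∀ S v → liftSet S (L v) ≡ S v ∧ W v
  liftSet-L S v = cong (liftSide S) (splitAt-L v)

  liftSet-R : ∀ S v → liftSet S (R v) ≡ false
  liftSet-R S v = cong (liftSide S) (splitAt-R v)

  liftSet-stable : ∀ {S} → Stable G S → Stable H (liftSet S)
  liftSet-stable {S} stable a b = lifted (splitAt n a) (splitAt n b)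
    where
    lifted : ∀ a′ b′ → AdjLR a′ b′ → ¬ (liftSide S a′ ≡ true × liftSide S b′ ≡ true)
    lifted (inj₁ u) (inj₁ v) (uv , _) (Su∧Wu , Sv∧Wv) =
      stable u v uv (Boolₚ.∧-conicalˡ _ _ Su∧Wu , Boolₚ.∧-conicalˡ _ _ Sv∧Wv)
    lifted (inj₁ u) (inj₂ v) _ (_ , ())
    lifted (inj₂ u) _        _ (() , _)

  liftAll : List (ℚ × VSet n) → List (ℚ × VSet (n + n))
  liftAll []             = []
  liftAll ((l , S) ∷ cs) = (l , liftSet S) ∷ liftAll cs

  liftAll-ok : ∀ cs → AllStableNonneg G cs → AllStableNonneg H (liftAll cs)
  liftAll-ok []             _                      = _
  liftAll-ok ((l , S) ∷ cs) (0≤l , stable , cs-ok) = 0≤l , liftSet-stable stable , liftAll-ok cs cs-ok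

  weightSum-liftAll : ∀ cs → weightSum (liftAll cs) ≡ weightSum cs
  weightSum-liftAll []             = refl
  weightSum-liftAll ((l , S) ∷ cs) = cong (l +ℚ_) (weightSum-liftAll cs)

  combo-liftAll : ∀ cs z → combo (liftAll cs) z ≡ weightedSum cs (λ S → χ (liftSet S) z)
  combo-liftAll []             z = refl
  combo-liftAll ((l , S) ∷ cs) z = cong (l *ℚ χ (liftSet S) z +ℚ_) (combo-liftAll cs z)

  combo-liftAll-in : ∀ cs {v} → W v ≡ true → combo (liftAll cs) (L v) ≡ combo cs v
  combo-liftAll-in cs {v} Wv = begin
    combo (liftAll cs) (L v)                    ≡⟨ combo-liftAll cs (L v) ⟩
    weightedSum cs (λ S → χ (liftSet S) (L v))  ≡⟨ weightedSum-cong cs (λ S → χ-cong (liftSet S) S (S∧W≡S S)) ⟩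
    weightedSum cs (λ S → χ S v)                ≡⟨ sym (combo≡weightedSum cs v) ⟩
    combo cs v                                  ∎
    where
    open ≡-Reasoning
    S∧W≡S : ∀ S → liftSet S (L v) ≡ S v
    S∧W≡S S = trans (liftSet-L S v) (trans (cong (S v ∧_) Wv) (Boolₚ.∧-identityʳ (S v)))

  combo-liftAll-out : ∀ cs {v} → W v ≡ false → combo (liftAll cs) (L v) ≡ 0ℚ
  combo-liftAll-out cs {v} Wv =
    trans (combo-liftAll cs (L v)) (trans (weightedSum-cong cs absent) (weightedSum-zero cs))
    where
    absent : ∀ S → χ (liftSet S) (L v) ≡ 0ℚ
    absent S = χ-false (liftSet S) (trans (liftSet-L S v) (trans (cong (S v ∧_) Wv) (Boolₚ.∧-zeroʳ (S v))))

  combo-liftAll-R : ∀ cs v → combo (liftAll cs) (R v) ≡ 0ℚ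
  combo-liftAll-R cs v = trans (combo-liftAll cs (R v))
    (trans (weightedSum-cong cs (λ S → χ-false (liftSet S) (liftSet-R S v))) (weightedSum-zero cs))

  liftPoint : (Fin n → ℚ) → Fin (n + n) → ℚ
  liftPoint y z = [ y , (λ _ → 0ℚ) ]′ (splitAt n z)

  liftPoint-L : ∀ y v → liftPoint y (L v) ≡ y v
  liftPoint-L y v = cong [ y , _ ]′ (splitAt-L v)

  liftPoint-R : ∀ y v → liftPoint y (R v) ≡ 0ℚ
  liftPoint-R y v = cong [ y , _ ]′ (splitAt-R v)

  liftSTAB : ∀ {y} → (∀ v → W v ≡ false → y v ≡ 0ℚ) → InSTAB G y → InSTAB H (liftPoint y)
  liftSTAB {y} y-off (cs , ok , total , cs≗y) =
    liftAll cs , liftAll-ok cs ok , trans (weightSum-liftAll cs) total , λ z → atVertex (L-or-R z)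
    where
    atVertex : ∀ {z} → (∃ λ v → z ≡ L v) ⊎ (∃ λ v → z ≡ R v) → combo (liftAll cs) z ≡ liftPoint y z
    atVertex (inj₂ (v , refl)) = trans (combo-liftAll-R cs v) (sym (liftPoint-R y v))
    atVertex (inj₁ (v , refl)) with W v in Wv
    ... | true  = trans (combo-liftAll-in cs Wv) (trans (cs≗y v) (sym (liftPoint-L y v)))
    ... | false = trans (combo-liftAll-out cs Wv) (trans (sym (y-off v Wv)) (sym (liftPoint-L y v)))

  module _ (perfect : TPerfect G) {x : Fin (n + n) → ℚ} (x-TSTAB : InTSTAB H x) where

    private
      x-nonNeg : ∀ z → 0ℚ ≤ℚ x z
      x-nonNeg = proj₁ x-TSTAB

      x-edge : EdgeBounded H x
      x-edge = proj₁ (proj₂ x-TSTAB)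

    xL≤1 : ∀ v → x (L v) ≤ℚ 1ℚ
    xL≤1 v = begin
      x (L v)             ≡⟨ sym (+-identityʳ (x (L v))) ⟩
      x (L v) +ℚ 0ℚ       ≤⟨ +-monoʳ-≤ (x (L v)) (x-nonNeg (R v)) ⟩
      x (L v) +ℚ x (R v)  ≤⟨ x-edge _ _ (adj-LR v) ⟩
      1ℚ                  ∎
      where open ≤-Reasoning

    restrict : Fin n → ℚ
    restrict v = if W v then x (L v) else 0ℚ

    restrict-TSTAB : InTSTAB G restrict
    restrict-TSTAB = InTSTAB-fromSupport {W = W} nonNeg edges (λ v → cong (if_then x (L v) else 0ℚ)) cycles
      where
      nonNeg : ∀ v → 0ℚ ≤ℚ restrict v
      nonNeg v with W v
      ... | true  = x-nonNeg (L v)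
      ... | false = ≤-refl

      edges : EdgeBounded G restrict
      edges u v uv with W u in Wu | W v in Wv
      ... | true  | true  = x-edge _ _ (adj-LL uv Wu Wv)
      ... | true  | false = ≤-trans (≤-reflexive (+-identityʳ (x (L u)))) (xL≤1 u)
      ... | false | true  = ≤-trans (≤-reflexive (+-identityˡ (x (L v)))) (xL≤1 v)
      ... | false | false = 0≤1

      cycles : ∀ C → CycleIn W C → Σℚ (λ p → restrict (vert C p)) ≤ℚ fromℕℚ (suc (j C))
      cycles C C⊆W = ≤-trans (≤-reflexive (Σℚ-cong (λ p → cong (if_then x (L (vert C p)) else 0ℚ) (C⊆W p))))
                             (proj₂ (proj₂ x-TSTAB) (lift C C⊆W))

    base : Fin (n + n) → ℚ
    base = liftPoint restrict

    base-STAB : InSTAB H base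
    base-STAB = liftSTAB (λ v → cong (if_then x (L v) else 0ℚ)) (proj₂ (perfect restrict) restrict-TSTAB)

    base-R : ∀ v → base (R v) ≡ 0ℚ
    base-R = liftPoint-R restrict

    base-L : ∀ {v} → W v ≡ true → base (L v) ≡ x (L v)
    base-L {v} Wv = trans (liftPoint-L restrict v) (cong (if_then x (L v) else 0ℚ) Wv)

    complete : Fin n → (Fin (n + n) → ℚ) → Fin (n + n) → ℚ
    complete v p = updateAt (updateAt p (L v) (λ _ → x (L v))) (R v) (λ _ → x (R v))

    complete-L : ∀ v p → complete v p (L v) ≡ x (L v)
    complete-L v p = trans (updateAt-minimal (L v) (R v) _ (L≢R v v)) (updateAt-updates (L v) p)

    complete-R : ∀ v p → complete v p (R v) ≡ x (R v)
    complete-R v p = updateAt-updates (R v) _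

    complete-other : ∀ {v z} p → z ≢ L v → z ≢ R v → complete v p z ≡ p z
    complete-other {v} {z} p z≢Lv z≢Rv =
      trans (updateAt-minimal z (R v) _ z≢Rv) (updateAt-minimal z (L v) p z≢Lv)

    fill : List (Fin n) → Fin (n + n) → ℚ
    fill []       = base
    fill (v ∷ vs) = complete v (fill vs)

    fill-base-or-x : ∀ vs z → fill vs z ≡ base z ⊎ fill vs z ≡ x z
    fill-base-or-x []       z = inj₁ refl
    fill-base-or-x (v ∷ vs) z with z Fin.≟ L v | z Fin.≟ R v
    ... | yes refl | _        = inj₂ (complete-L v (fill vs))
    ... | no  _    | yes refl = inj₂ (complete-R v (fill vs))
    ... | no  z≢Lv | no  z≢Rv rewrite complete-other (fill vs) z≢Lv z≢Rv = fill-base-or-x vs z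

    fill-R≤ : ∀ vs v → fill vs (R v) ≤ℚ x (R v)
    fill-R≤ vs v with fill-base-or-x vs (R v)
    ... | inj₁ eq = ≤-trans (≤-reflexive (trans eq (base-R v))) (x-nonNeg (R v))
    ... | inj₂ eq = ≤-reflexive eq

    fill-L : ∀ vs {v} → W v ≡ true → fill vs (L v) ≡ x (L v)
    fill-L vs {v} Wv with fill-base-or-x vs (L v)
    ... | inj₁ eq = trans eq (base-L Wv)
    ... | inj₂ eq = eq

    fill-done : ∀ {vs v} → v ∈ vs → fill vs (L v) ≡ x (L v) × fill vs (R v) ≡ x (R v)
    fill-done {u ∷ vs} {v} v∈u∷vs with v Fin.≟ u | v∈u∷vs
    ... | yes refl | _            = complete-L v (fill vs) , complete-R v (fill vs)
    ... | no  v≢u  | here v≡u     = contradiction v≡u v≢u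
    ... | no  v≢u  | there v∈vs   =
      trans (complete-other (fill vs) (v≢u ∘ L-injective) (L≢R v u)) (proj₁ (fill-done v∈vs)) ,
      trans (complete-other (fill vs) (L≢R u v ∘ sym) (v≢u ∘ R-injective)) (proj₂ (fill-done v∈vs))

    -- Completing v first fixes L v (a pendant vertex of R v when v ∉ W), then R v
    -- (a pendant vertex of L v).
    fill-STAB : ∀ vs → InSTAB H (fill vs)
    fill-STAB []       = base-STAB
    fill-STAB (v ∷ vs) = extendPendant (R-pendant v) withL (x (R v)) (x-nonNeg (R v)) R-bound
      where
      p : Fin (n + n) → ℚ
      p = fill vs

      withL : InSTAB H (updateAt p (L v) (λ _ → x (L v)))
      withL with W v in Wv
      ... | true  = InSTAB-resp (λ z → sym (updateAt-id-local (L v) p (sym (fill-L vs Wv)) z)) (fill-STAB vs)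
      ... | false = extendPendant (L-pendant Wv) (fill-STAB vs) (x (L v)) (x-nonNeg (L v))
                      (≤-trans (+-monoʳ-≤ (x (L v)) (fill-R≤ vs v)) (x-edge _ _ (adj-LR v)))

      R-bound : x (R v) +ℚ updateAt p (L v) (λ _ → x (L v)) (L v) ≤ℚ 1ℚ
      R-bound = ≤-trans (≤-reflexive (cong (x (R v) +ℚ_) (updateAt-updates (L v) p)))
                        (x-edge _ _ (Graph.sym H (adj-LR v)))

    TSTAB⊆STAB : InSTAB H x
    TSTAB⊆STAB = InSTAB-resp filled (fill-STAB (allFin n))
      where
      filled : ∀ z → fill (allFin n) z ≡ x z
      filled z with L-or-R z
      ... | inj₁ (v , refl) = proj₁ (fill-done (∈-allFin v))
      ... | inj₂ (v , refl) = proj₂ (fill-done (∈-allFin v))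

  t-perfect : TPerfect G → TPerfect H
  t-perfect perfect x = STAB⊆TSTAB , TSTAB⊆STAB perfect

  restrictColouring : ∀ {c} → Colourable c H →
    ∃ λ (T : Fin c → VSet n) → (∀ a → Stable G (T a)) × (∀ v → W v ≡ true → ∃ λ a → T a v ≡ true)
  restrictColouring {c} (T , T-stable , T-covers) = T′ , T′-stable , T′-covers
    where
    T′ : Fin c → VSet n
    T′ a v = T a (L v) ∧ W v

    T′-stable : ∀ a → Stable G (T′ a)
    T′-stable a u v uv (T′u , T′v) =
      T-stable a (L u) (L v) (adj-LL uv (Boolₚ.∧-conicalʳ _ _ T′u) (Boolₚ.∧-conicalʳ _ _ T′v))
        (Boolₚ.∧-conicalˡ _ _ T′u , Boolₚ.∧-conicalˡ _ _ T′v)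

    T′-covers : ∀ v → W v ≡ true → ∃ λ a → T′ a v ≡ true
    T′-covers v Wv = proj₁ (T-covers (L v)) , cong₂ _∧_ (proj₂ (T-covers (L v))) Wv

Colourable-++ : ∀ {n c k} {G : Graph n} (T : Fin c → VSet n) (U : Fin k → VSet n) →
  (∀ a → Stable G (T a)) → (∀ b → Stable G (U b)) →
  (∀ v → (∃ λ a → T a v ≡ true) ⊎ (∃ λ b → U b v ≡ true)) → Colourable (c + k) G
Colourable-++ {k = k} {G} T U T-stable U-stable covers =
  T ++ U , ++⁺ (Stable G) T-stable U-stable , λ v → [ inT v , inU v ]′ (covers v)
  where
  inT : ∀ v → (∃ λ a → T a v ≡ true) → ∃ λ i → (T ++ U) i v ≡ true
  inT v (a , Tav) = a ↑ˡ k , trans (cong (λ S → S v) (lookup-++ˡ T U a)) Tav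
  inU : ∀ v → (∃ λ b → U b v ≡ true) → ∃ λ i → (T ++ U) i v ≡ true
  inU v (b , Ubv) = _ ↑ʳ b , trans (cong (λ S → S v) (lookup-++ʳ T U b)) Ubv

lemma3p2 : (k c : ℕ) → 1 ≤ k → 1 ≤ c →
    (∀ n (G : Graph n) → TPerfect G → NoShortOddCycle k G → Colourable c G) →
    ∀ n (G : Graph n) → TPerfect G → Colourable (c + k) G
lemma3p2 k c _ _ colourGirth n G perfect =
  combine (restrictColouring (colourGirth (n + n) H (t-perfect perfect) (noShortOddCycle (rest-long P))))
  where
  P : Peeling G k
  P = peel perfect k

  open Pendant G (rest P)

  combine : (∃ λ T → (∀ a → Stable G (T a)) × (∀ v → rest P v ≡ true → ∃ λ a → T a v ≡ true)) →
    Colourable (c + k) G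
  combine (T , T-stable , T-covers) =
    Colourable-++ {G = G} T (layer P) T-stable (layer-stable P)
      (λ v → [ inj₁ ∘ T-covers v , inj₂ ]′ (covered P v))
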